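{- Let $k>2$ and let $(A_i)_{i<k}$ be a partition of $\mathbb{N}$ into nonempty pairwise disjoint sets, at least three of which are infinite. Let $\varphi$ be the coloring associated to the partition. Then for every finite $a\subseteq[\mathbb{N}]^2$ the finite change $\varphi_a$ is reconstructible.
   Context: A coloring on $\mathbb{N}$ is a function $\varphi:[\mathbb{N}]^2\to\{0,1\}$. The coloring associated to a partition $(A_i)_i$ is $\varphi(\{x,y\})=1$ iff $x,y\in A_i$ for some $i$. For finite $a\subseteq[\mathbb{N}]^2$, $\varphi_a(e)=\varphi(e)$ for $e\notin a$ and $\varphi_a(e)=1-\varphi(e)$ for $e\in a$. $\mathrm{hom}(\varphi)=\{H\subseteq\mathbb{N}:\ |H|>2 \text{ and } \varphi \text{ is constant on } [H]^2\}$. $\varphi$ is reconstructible if for every coloring $\psi$ on $\mathbb{N}$ with $\mathrm{hom}(\psi)=\mathrm{hom}(\varphi)$ one has $\psi=\varphi$ or $\psi=1-\varphi$. -}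

module Defs where

open import Data.Nat using (ℕ; _<_; _≤_; _≟_)
open import Data.Bool using (Bool; true; false; not; if_then_else_)
open import Data.Fin using (Fin)
open import Data.List using (List)
open import Data.List.Membership.Propositional using (_∈_)
open import Data.Product using (Σ; ∃; _×_; _,_)
open import Data.Sum using (_⊎_)
open import Relation.Nullary using (¬_; Dec; yes; no)
open import Relation.Nullary.Decidable using (⌊_⌋)
open import Relation.Binary.PropositionalEquality using (_≡_)
open import Data.Product.Properties using (≡-dec)
open import Function.Bundles using (_⇔_)
import Data.List.Membership.DecPropositional as DecMem

-- A coloring of [ℕ]²: only the values φ x y with x < y are meaningful
-- (the pair {x,y} with x < y is coded by φ x y).
Coloring : Set
Coloring = ℕ → ℕ → Bool

_≐_ : Coloring → Coloring → Set
φ ≐ ψ = ∀ x y → x < y → φ x y ≡ ψ x y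

complement : Coloring → Coloring
complement φ x y = not (φ x y)

partitionColoring : {k : ℕ} → (ℕ → Fin k) → Coloring
partitionColoring part x y = ⌊ Data.Fin._≟_ (part x) (part y) ⌋

FinEdgeSet : Set
FinEdgeSet = List (ℕ × ℕ)

IsEdgeList : FinEdgeSet → Set
IsEdgeList a = ∀ {x y} → (x , y) ∈ a → x < y

_∈?ₑ_ : (e : ℕ × ℕ) → (a : FinEdgeSet) → Dec (e ∈ a)
e ∈?ₑ a = DecMem._∈?_ (≡-dec _≟_ _≟_) e a

finiteChange : Coloring → FinEdgeSet → Coloring
finiteChange φ a x y = if ⌊ (x , y) ∈?ₑ a ⌋ then not (φ x y) else φ x y

AtLeastThree : (ℕ → Set) → Set
AtLeastThree H = Σ ℕ λ x → Σ ℕ λ y → Σ ℕ λ z →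
  H x × H y × H z × ¬ x ≡ y × ¬ x ≡ z × ¬ y ≡ z

ConstantOn : Coloring → (ℕ → Set) → Set
ConstantOn φ H = Σ Bool λ c → ∀ x y → H x → H y → x < y → φ x y ≡ c

InHom : Coloring → (ℕ → Set) → Set
InHom φ H = AtLeastThree H × ConstantOn φ H

SameHom : Coloring → Coloring → Set₁
SameHom φ ψ = ∀ (H : ℕ → Set) → InHom φ H ⇔ InHom ψ H

Reconstructible : Coloring → Set₁
Reconstructible φ = ∀ (ψ : Coloring) → SameHom ψ φ → (ψ ≐ φ) ⊎ (ψ ≐ complement φ)

InfiniteClass : {k : ℕ} → (ℕ → Fin k) → Fin k → Set
InfiniteClass part i = ∀ n → Σ ℕ λ m → n ≤ m × part m ≡ i

NonemptyClass : {k : ℕ} → (ℕ → Fin k) → Fin k → Set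
NonemptyClass part i = Σ ℕ λ m → part m ≡ i

-- Let ψ satisfy hom(ψ) = hom(φ_a) and let δ mark the pairs on which ψ and φ_a differ.
-- The two colorings have the same monochromatic triangles, so δ is constant on every
-- φ_a-monochromatic triangle, and if two sides of a triangle agree both in φ_a and in δ,
-- the third side has the same δ as well. On pairs with an endpoint beyond every vertex
-- touched by a, φ_a is 0 between different classes; since three classes are infinite,
-- such triangles with vertices in three distinct classes exist around any pair, and they
-- carry the value of δ to every pair. So δ is constant: ψ = φ_a or ψ = 1 - φ_a.
module Submission where

open import Defs
open import Data.Nat using (ℕ; _<_)
open import Data.Fin using (Fin)
open import Data.Product using (Σ; _×_)
open import Relation.Nullary using (¬_)
open import Relation.Binary.PropositionalEquality using (_≡_)

open import Data.Nat using (suc; _≤_; _⊔_; _<ᵇ_)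
open import Data.Nat.Properties using (<⇒<ᵇ; <ᵇ⇒<; <-asym; <⇒≢; <⇒≤; <-cmp; <⇒≱; ≤-trans; m≤m⊔n; m≤n⊔m; <-≤-trans)
open import Data.Bool using (Bool; true; false; not; _xor_; if_then_else_)
open import Data.Bool.Properties using (_≟_; not-¬; ¬-not; xor-same; xor-inverseˡ)
import Data.Fin.Properties as Fin
open import Data.List using ([]; _∷_)
open import Data.List.Relation.Unary.Any using (here; there)
open import Data.List.Membership.Propositional using (_∈_)
open import Data.Product using (_,_; proj₁)
open import Data.Sum using (_⊎_; inj₁; inj₂; swap)
open import Function using (_∘_)
open import Function.Bundles using (_⇔_; mk⇔; Equivalence)
import Function.Properties.Equivalence as ⇔
open import Relation.Nullary using (yes; no; contradiction)
open import Relation.Nullary.Decidable using (isYes≗does; dec-false)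
open import Relation.Binary.Definitions using (DecidableEquality; tri<; tri≈; tri>)
open import Relation.Binary.PropositionalEquality using (_≢_; refl; sym; trans; cong; cong₂; module ≡-Reasoning)

open Equivalence using (to; from)

xor-cancelʳ : ∀ {a} b c → b xor a ≡ c xor a → b ≡ c
xor-cancelʳ false false _ = refl
xor-cancelʳ true  true  _ = refl
xor-cancelʳ false true  e = contradiction e (not-¬ refl)
xor-cancelʳ true  false e = contradiction (sym e) (not-¬ refl)

not-xor-not : ∀ a b → not a xor not b ≡ a xor b
not-xor-not false false = refl
not-xor-not false true  = refl
not-xor-not true  false = refl
not-xor-not true  true  = refl

xor-≡-if-≡⇔≡ : ∀ {a₁ a₂ b₁ b₂} → (a₁ ≡ a₂ ⇔ b₁ ≡ b₂) → b₁ xor a₁ ≡ b₂ xor a₂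
xor-≡-if-≡⇔≡ {a₁} {a₂} {b₂ = b₂} a≡⇔b≡ with a₁ ≟ a₂
... | yes refl = cong (_xor a₁) (to a≡⇔b≡ refl)
... | no a₁≢a₂ = trans (cong₂ _xor_ (¬-not (a₁≢a₂ ∘ from a≡⇔b≡)) (¬-not a₁≢a₂)) (not-xor-not b₂ a₂)

colorOf : Coloring → ℕ → ℕ → Bool
colorOf φ x y = if x <ᵇ y then φ x y else φ y x

colorOf-< : ∀ φ {x y} → x < y → colorOf φ x y ≡ φ x y
colorOf-< φ {x} {y} x<y with x <ᵇ y | <⇒<ᵇ x<y
... | true | _ = refl

colorOf-> : ∀ φ {x y} → y < x → colorOf φ x y ≡ φ y x
colorOf-> φ {x} {y} y<x with x <ᵇ y | <ᵇ⇒< x y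
... | false | _   = refl
... | true  | x<y = contradiction (x<y _) (<-asym y<x)

colorOf-comm : ∀ φ {x y} → x ≢ y → colorOf φ x y ≡ colorOf φ y x
colorOf-comm φ {x} {y} x≢y with <-cmp x y
... | tri< x<y _ _ = trans (colorOf-< φ x<y) (sym (colorOf-> φ x<y))
... | tri≈ _ x≡y _ = contradiction x≡y x≢y
... | tri> _ _ y<x = trans (colorOf-> φ y<x) (sym (colorOf-< φ y<x))

constantOn-colorOf : ∀ {φ H x y} → ((c , _) : ConstantOn φ H) → H x → H y → x ≢ y → colorOf φ x y ≡ c
constantOn-colorOf {φ} {x = x} {y} (c , const) Hx Hy x≢y with <-cmp x y
... | tri< x<y _ _ = trans (colorOf-< φ x<y) (const x y Hx Hy x<y)
... | tri≈ _ x≡y _ = contradiction x≡y x≢y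
... | tri> _ _ y<x = trans (colorOf-> φ y<x) (const y x Hy Hx y<x)

Distinct : ℕ → ℕ → ℕ → Set
Distinct p q r = p ≢ q × p ≢ r × q ≢ r

triple : ℕ → ℕ → ℕ → ℕ → Set
triple p q r w = w ≡ p ⊎ w ≡ q ⊎ w ≡ r

Monochromatic : Coloring → ℕ → ℕ → ℕ → Set
Monochromatic φ p q r = colorOf φ p q ≡ colorOf φ p r × colorOf φ p r ≡ colorOf φ q r

monochromatic-edge : ∀ {φ p q r x y} → Monochromatic φ p q r
  → triple p q r x → triple p q r y → x ≢ y → colorOf φ x y ≡ colorOf φ p q
monochromatic-edge _ (inj₁ refl) (inj₁ refl) x≢y = contradiction refl x≢y
monochromatic-edge _ (inj₁ refl) (inj₂ (inj₁ refl)) _ = refl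
monochromatic-edge (pq≡pr , _) (inj₁ refl) (inj₂ (inj₂ refl)) _ = sym pq≡pr
monochromatic-edge {φ} _ (inj₂ (inj₁ refl)) (inj₁ refl) x≢y = colorOf-comm φ x≢y
monochromatic-edge _ (inj₂ (inj₁ refl)) (inj₂ (inj₁ refl)) x≢y = contradiction refl x≢y
monochromatic-edge (pq≡pr , pr≡qr) (inj₂ (inj₁ refl)) (inj₂ (inj₂ refl)) _ = sym (trans pq≡pr pr≡qr)
monochromatic-edge {φ} (pq≡pr , _) (inj₂ (inj₂ refl)) (inj₁ refl) x≢y =
  trans (colorOf-comm φ x≢y) (sym pq≡pr)
monochromatic-edge {φ} (pq≡pr , pr≡qr) (inj₂ (inj₂ refl)) (inj₂ (inj₁ refl)) x≢y =
  trans (colorOf-comm φ x≢y) (sym (trans pq≡pr pr≡qr))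
monochromatic-edge _ (inj₂ (inj₂ refl)) (inj₂ (inj₂ refl)) x≢y = contradiction refl x≢y

inHom-triple⇔monochromatic : ∀ {φ p q r} → Distinct p q r → InHom φ (triple p q r) ⇔ Monochromatic φ p q r
inHom-triple⇔monochromatic {φ} {p} {q} {r} (p≢q , p≢r , q≢r) = mk⇔
  (λ (_ , const) → trans (constantOn-colorOf const P Q p≢q) (sym (constantOn-colorOf const P R p≢r))
                 , trans (constantOn-colorOf const P R p≢r) (sym (constantOn-colorOf const Q R q≢r)))
  (λ mono → (p , q , r , P , Q , R , p≢q , p≢r , q≢r)
          , (colorOf φ p q , λ x y Hx Hy x<y →
               trans (sym (colorOf-< φ x<y)) (monochromatic-edge mono Hx Hy (<⇒≢ x<y))))
  where
  P : triple p q r p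
  P = inj₁ refl
  Q : triple p q r q
  Q = inj₂ (inj₁ refl)
  R : triple p q r r
  R = inj₂ (inj₂ refl)

module SameHomColorings (ψ χ : Coloring) (same : SameHom ψ χ) where

  monochromatic⇔ : ∀ {p q r} → Distinct p q r → Monochromatic ψ p q r ⇔ Monochromatic χ p q r
  monochromatic⇔ {p} {q} {r} d = ⇔.trans (⇔.sym (inHom-triple⇔monochromatic d))
    (⇔.trans (same (triple p q r)) (inHom-triple⇔monochromatic d))

  δ : ℕ → ℕ → Bool
  δ x y = colorOf ψ x y xor colorOf χ x y

  δ-comm : ∀ {x y} → x ≢ y → δ x y ≡ δ y x
  δ-comm x≢y = cong₂ _xor_ (colorOf-comm ψ x≢y) (colorOf-comm χ x≢y)

  δ-monochromatic : ∀ {p q r} → Distinct p q r → Monochromatic χ p q r → δ p q ≡ δ p r × δ p r ≡ δ q r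
  δ-monochromatic d (χpq≡χpr , χpr≡χqr) with from (monochromatic⇔ d) (χpq≡χpr , χpr≡χqr)
  ... | ψpq≡ψpr , ψpr≡ψqr = cong₂ _xor_ ψpq≡ψpr χpq≡χpr , cong₂ _xor_ ψpr≡ψqr χpr≡χqr

  δ-third-side : ∀ {p q r} → Distinct p q r
    → colorOf χ p r ≡ colorOf χ q r → δ p r ≡ δ q r → δ p q ≡ δ p r
  δ-third-side {p} {q} {r} d χpr≡χqr δpr≡δqr = xor-≡-if-≡⇔≡ (mk⇔
    (λ χpq≡χpr → proj₁ (from (monochromatic⇔ d) (χpq≡χpr , χpr≡χqr)))
    (λ ψpq≡ψpr → proj₁ (to (monochromatic⇔ d) (ψpq≡ψpr , ψpr≡ψqr))))
    where
    ψpr≡ψqr : colorOf ψ p r ≡ colorOf ψ q r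
    ψpr≡ψqr = xor-cancelʳ _ _ (trans δpr≡δqr (cong (colorOf ψ q r xor_) (sym χpr≡χqr)))

  δ-< : ∀ {x y} → x < y → δ x y ≡ ψ x y xor χ x y
  δ-< x<y = cong₂ _xor_ (colorOf-< ψ x<y) (colorOf-< χ x<y)

  δ-constant⇒ : ∀ c → (∀ {x y} → x ≢ y → δ x y ≡ c) → (ψ ≐ χ) ⊎ (ψ ≐ complement χ)
  δ-constant⇒ false δ≡false = inj₁ λ x y x<y → xor-cancelʳ (ψ x y) (χ x y)
    (trans (sym (δ-< x<y)) (trans (δ≡false (<⇒≢ x<y)) (sym (xor-same (χ x y)))))
  δ-constant⇒ true δ≡true = inj₂ λ x y x<y → xor-cancelʳ (ψ x y) (not (χ x y))
    (trans (sym (δ-< x<y)) (trans (δ≡true (<⇒≢ x<y)) (sym (xor-inverseˡ (χ x y)))))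

ThreeDistinct : {A : Set} → (A → Set) → Set
ThreeDistinct {A} P = Σ A λ i → Σ A λ j → Σ A λ l → ¬ i ≡ j × ¬ i ≡ l × ¬ j ≡ l × P i × P j × P l

one-of-two-avoiding : ∀ {A : Set} {P : A → Set} → DecidableEquality A → ∀ {j l c}
  → j ≢ l → P j → P l → j ≢ c → l ≢ c → (d : A) → Σ A λ e → P e × e ≢ c × e ≢ d
one-of-two-avoiding _≟ᴬ_ {j} j≢l Pj Pl j≢c l≢c d with j ≟ᴬ d
... | no j≢d = j , Pj , j≢c , j≢d
... | yes refl = _ , Pl , l≢c , j≢l ∘ sym

avoiding-two : ∀ {A : Set} {P : A → Set} → DecidableEquality A → ThreeDistinct P
  → (c d : A) → Σ A λ e → P e × e ≢ c × e ≢ d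
avoiding-two _≟ᴬ_ (i , j , l , i≢j , i≢l , j≢l , Pi , Pj , Pl) c d with i ≟ᴬ c | i ≟ᴬ d
... | no i≢c | no i≢d = i , Pi , i≢c , i≢d
... | yes refl | _ = one-of-two-avoiding _≟ᴬ_ j≢l Pj Pl (i≢j ∘ sym) (i≢l ∘ sym) d
... | no _ | yes refl with one-of-two-avoiding _≟ᴬ_ j≢l Pj Pl (i≢j ∘ sym) (i≢l ∘ sym) c
...   | e , Pe , e≢d , e≢c = e , Pe , e≢c , e≢d

SeparatesClassesFrom : ∀ {k} → (ℕ → Fin k) → ℕ → Coloring → Set
SeparatesClassesFrom part M χ = ∀ {x y} → x < y → M ≤ y → part x ≢ part y → χ x y ≡ false

module SeparatingColoring {k} (part : ℕ → Fin k) (infinite : ThreeDistinct (InfiniteClass part))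
  (M : ℕ) (χ : Coloring) (separates : SeparatesClassesFrom part M χ)
  (ψ : Coloring) (same : SameHom ψ χ) where

  open SameHomColorings ψ χ same

  Fresh : ℕ → ℕ → Set
  Fresh x y = M ≤ x ⊎ M ≤ y

  Rainbow : ℕ → ℕ → ℕ → Set
  Rainbow x y z = part x ≢ part y × part x ≢ part z × part y ≢ part z

  classes-distinct : ∀ {x y} → part x ≢ part y → x ≢ y
  classes-distinct ne = ne ∘ cong part

  fresh-upper : ∀ {x y} → x < y → Fresh x y → M ≤ y
  fresh-upper x<y (inj₁ M≤x) = ≤-trans M≤x (<⇒≤ x<y)
  fresh-upper _   (inj₂ M≤y) = M≤y

  colorOf-cross : ∀ {x y} → part x ≢ part y → Fresh x y → colorOf χ x y ≡ false
  colorOf-cross {x} {y} ne fresh with <-cmp x y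
  ... | tri< x<y _ _ = trans (colorOf-< χ x<y) (separates x<y (fresh-upper x<y fresh) ne)
  ... | tri≈ _ x≡y _ = contradiction x≡y (classes-distinct ne)
  ... | tri> _ _ y<x = trans (colorOf-> χ y<x) (separates y<x (fresh-upper y<x (swap fresh)) (ne ∘ sym))

  freshVertex : (c d : Fin k) → Σ ℕ λ z → M ≤ z × c ≢ part z × d ≢ part z
  freshVertex c d with avoiding-two Fin._≟_ infinite c d
  ... | e , infinite-e , e≢c , e≢d with infinite-e M
  ...   | z , M≤z , refl = z , M≤z , e≢c ∘ sym , e≢d ∘ sym

  rainbow : ∀ {x y z} → Rainbow x y z → Fresh x y → M ≤ z → δ x y ≡ δ x z
  rainbow (xy , xz , yz) fresh M≤z = proj₁ (δ-monochromatic
    (classes-distinct xy , classes-distinct xz , classes-distinct yz)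
    ( trans (colorOf-cross xy fresh) (sym (colorOf-cross xz (inj₂ M≤z)))
    , trans (colorOf-cross xz (inj₂ M≤z)) (sym (colorOf-cross yz (inj₂ M≤z)))))

  -- A second fresh vertex w from a third class mediates when y and z share a class.
  row : ∀ {x y z} → part x ≢ part y → Fresh x y → part x ≢ part z → M ≤ z → δ x y ≡ δ x z
  row {x} {y} {z} xy fresh xz M≤z with part y Fin.≟ part z | freshVertex (part x) (part y)
  ... | no yz | _ = rainbow (xy , xz , yz) fresh M≤z
  ... | yes y≡z | w , M≤w , xw , yw =
    trans (rainbow (xy , xw , yw) fresh M≤w)
      (sym (rainbow (xz , xw , λ z≡w → yw (trans y≡z z≡w)) (inj₂ M≤z) M≤w))

  pivot : ℕ → ℕ
  pivot x = proj₁ (freshVertex (part x) (part x))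

  δ-row : ∀ {x y} → part x ≢ part y → Fresh x y → δ x y ≡ δ x (pivot x)
  δ-row {x} xy fresh with freshVertex (part x) (part x)
  ... | v , M≤v , xv , _ = row xy fresh xv M≤v

  δ-pivot-unique : ∀ x y → δ x (pivot x) ≡ δ y (pivot y)
  δ-pivot-unique x y with freshVertex (part x) (part y)
  ... | z , M≤z , xz , yz = begin
    δ x (pivot x) ≡⟨ sym (δ-row xz (inj₂ M≤z)) ⟩
    δ x z         ≡⟨ δ-comm (classes-distinct xz) ⟩
    δ z x         ≡⟨ δ-row (xz ∘ sym) (inj₁ M≤z) ⟩
    δ z (pivot z) ≡⟨ sym (δ-row (yz ∘ sym) (inj₁ M≤z)) ⟩
    δ z y         ≡⟨ δ-comm (classes-distinct (yz ∘ sym)) ⟩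
    δ y z         ≡⟨ δ-row yz (inj₂ M≤z) ⟩
    δ y (pivot y) ∎
    where open ≡-Reasoning

  δ-constant : ∀ {x y} → x ≢ y → δ x y ≡ δ 0 (pivot 0)
  δ-constant {x} {y} x≢y with freshVertex (part x) (part y)
  ... | z , M≤z , xz , yz = begin
    δ x y         ≡⟨ δ-third-side (x≢y , classes-distinct xz , classes-distinct yz) χxz≡χyz δxz≡δyz ⟩
    δ x z         ≡⟨ δ-row xz (inj₂ M≤z) ⟩
    δ x (pivot x) ≡⟨ δ-pivot-unique x 0 ⟩
    δ 0 (pivot 0) ∎
    where
    open ≡-Reasoning
    χxz≡χyz : colorOf χ x z ≡ colorOf χ y z
    χxz≡χyz = trans (colorOf-cross xz (inj₂ M≤z)) (sym (colorOf-cross yz (inj₂ M≤z)))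
    δxz≡δyz : δ x z ≡ δ y z
    δxz≡δyz = trans (δ-row xz (inj₂ M≤z)) (trans (δ-pivot-unique x y) (sym (δ-row yz (inj₂ M≤z))))

  ψ≐χ⊎ψ≐complementχ : (ψ ≐ χ) ⊎ (ψ ≐ complement χ)
  ψ≐χ⊎ψ≐complementχ = δ-constant⇒ (δ 0 (pivot 0)) δ-constant

separatingColoring-reconstructible : ∀ {k} (part : ℕ → Fin k) → ThreeDistinct (InfiniteClass part)
  → ∀ M χ → SeparatesClassesFrom part M χ → Reconstructible χ
separatingColoring-reconstructible part infinite M χ separates ψ same =
  SeparatingColoring.ψ≐χ⊎ψ≐complementχ part infinite M χ separates ψ same

edgeBound : FinEdgeSet → ℕ
edgeBound [] = 0
edgeBound ((_ , y) ∷ a) = suc y ⊔ edgeBound a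

∈⇒<edgeBound : ∀ {x y} a → (x , y) ∈ a → y < edgeBound a
∈⇒<edgeBound ((_ , y) ∷ a) (here refl) = m≤m⊔n (suc y) (edgeBound a)
∈⇒<edgeBound ((_ , y) ∷ a) (there e∈a) = <-≤-trans (∈⇒<edgeBound a e∈a) (m≤n⊔m (suc y) (edgeBound a))

finiteChange-outside : ∀ φ a {x y} → ¬ (x , y) ∈ a → finiteChange φ a x y ≡ φ x y
finiteChange-outside φ a {x} {y} ∉a =
  cong (λ b → if b then not (φ x y) else φ x y) (trans (isYes≗does _) (dec-false ((x , y) ∈?ₑ a) ∉a))

partitionColoring-cross : ∀ {k} (part : ℕ → Fin k) {x y} → part x ≢ part y → partitionColoring part x y ≡ false
partitionColoring-cross part {x} {y} ne = trans (isYes≗does _) (dec-false (part x Fin.≟ part y) ne)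

finiteChange-separates : ∀ {k} (part : ℕ → Fin k) a
  → SeparatesClassesFrom part (edgeBound a) (finiteChange (partitionColoring part) a)
finiteChange-separates part a _ bound≤y ne =
  trans (finiteChange-outside (partitionColoring part) a (λ e∈a → <⇒≱ (∈⇒<edgeBound a e∈a) bound≤y))
    (partitionColoring-cross part ne)

mainTheorem18 : (k : ℕ) → 2 < k → (part : ℕ → Fin k)
    → (∀ i → NonemptyClass part i)
    → Σ (Fin k) (λ i → Σ (Fin k) λ j → Σ (Fin k) λ l →
        ¬ i ≡ j × ¬ i ≡ l × ¬ j ≡ l
        × InfiniteClass part i × InfiniteClass part j × InfiniteClass part l)
    → (a : FinEdgeSet) → IsEdgeList a
    → Reconstructible (finiteChange (partitionColoring part) a)
-- Three distinct classes already force k > 2.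
mainTheorem18 _ _ part _ infinite a _ =
  separatingColoring-reconstructible part infinite (edgeBound a) _ (finiteChange-separates part a)
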